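{- Let $(A,\le)$ be a partially ordered set, $a\in A$, and $w\in A_a^*$. Let $w'$ and $w''$ be two $a$-extensions of $w$ of the same length $n$ such that $w'\le w''$ in the product order of $A^n$, i.e. $w'_i\le w''_i$ in $A$ for all $i=1,\dots,n$. Then $w'=w''$.
   Context: All order relations are reflexive. For a set $X$, $X^*$ is the free monoid of finite words over $X$; $w_i$ denotes the $i$-th letter of a word $w$. $A_a=A\setminus\{a\}$ and $A_a^*=(A\setminus\{a\})^*$. A word $w'\in A^*$ is an $a$-extension of $w\in A_a^*$ if $w'$ is obtained from $w$ by inserting finitely many (possibly zero) copies of the letter $a$ at arbitrary positions. -}

module Defs where

open import Data.List using (List; []; _∷_)

data _IsExtOf_by_ {ℓ} {A : Set ℓ} : List A → List A → A → Set ℓ where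
  ext-[]   : ∀ {a} → [] IsExtOf [] by a
  ext-ins  : ∀ {a w w'} → w' IsExtOf w by a → (a ∷ w') IsExtOf w by a
  ext-keep : ∀ {a x w w'} → w' IsExtOf w by a → (x ∷ w') IsExtOf (x ∷ w) by a

module Submission where

open import Defs
open import Data.Empty using (⊥; ⊥-elim)
open import Data.List using (List; []; _∷_; _++_; _∷ʳ_; length)
open import Data.List.Properties using (∷ʳ-++)
open import Data.List.Relation.Unary.All using (All; []; _∷_)
open import Data.List.Relation.Unary.All.Properties using (∷ʳ⁺)
open import Data.List.Relation.Binary.Pointwise using (Pointwise; []; _∷_)
import Data.List.Relation.Binary.Pointwise as Pointwise
open import Data.Product using (_,_)
open import Relation.Binary.Structures using (IsPartialOrder)
open import Relation.Binary.PropositionalEquality using (_≡_; _≢_; refl; cong; subst; sym; ≢-sym)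
import Relation.Binary.Construct.Flip.EqAndOrd as Flip
import Relation.Binary.Construct.NonStrictToStrict as Strict

-- Write u' ≤ u'' for two a-extensions compared letterwise.  At the first
-- position where they differ, one of them (say u') reads an inserted a while
-- the other already reads the next letter of w, so u' falls behind.  From then
-- on the letters of w that u'' has consumed but u' has not form a queue, all
-- of whose entries lie strictly above a: a letter pushed onto it is read by
-- u'' against an a of u', and a popped letter x ≥ a is read by u' against
-- either a (forcing x = a, impossible) or a letter of w, which is then ≥ x ≥ a.
-- The queue never empties, so u' is strictly longer than u''.

module Lagging {ℓ ℓ'} {A : Set ℓ} {_≤_ : A → A → Set ℓ'}
               (po : IsPartialOrder _≡_ _≤_) (a : A) where

  open IsPartialOrder po using (trans; antisym)
  open Strict _≡_ _≤_ using (_<_; <⇒≱)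

  push : ∀ xs {u y v} → u IsExtOf (xs ++ y ∷ v) by a → u IsExtOf (xs ∷ʳ y ++ v) by a
  push xs {y = y} {v} = subst (λ w → _ IsExtOf w by a) (sym (∷ʳ-++ xs y v))

  lagging-extension-absurd : ∀ {x xs v u' u''} → All (a <_) (x ∷ xs) → All (_≢ a) v →
    u' IsExtOf (x ∷ xs ++ v) by a → u'' IsExtOf v by a → Pointwise _≤_ u' u'' → ⊥
  lagging-extension-absurd queue fresh (ext-ins e') (ext-ins e'') (_ ∷ pw) =
    lagging-extension-absurd queue fresh e' e'' pw
  lagging-extension-absurd {x} {xs} queue (y≢a ∷ fresh) (ext-ins e') (ext-keep e'') (a≤y ∷ pw) =
    lagging-extension-absurd (∷ʳ⁺ queue (a≤y , ≢-sym y≢a)) fresh (push (x ∷ xs) e') e'' pw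
  lagging-extension-absurd (a<x ∷ _) fresh (ext-keep e') (ext-ins e'') (x≤a ∷ _) =
    <⇒≱ antisym a<x x≤a
  lagging-extension-absurd {xs = []} ((a≤x , _) ∷ []) (y≢a ∷ fresh)
    (ext-keep e') (ext-keep e'') (x≤y ∷ pw) =
    lagging-extension-absurd ((trans a≤x x≤y , ≢-sym y≢a) ∷ []) fresh e' e'' pw
  lagging-extension-absurd {xs = xs@(_ ∷ _)} ((a≤x , _) ∷ queue) (y≢a ∷ fresh)
    (ext-keep e') (ext-keep e'') (x≤y ∷ pw) =
    lagging-extension-absurd (∷ʳ⁺ queue (trans a≤x x≤y , ≢-sym y≢a)) fresh (push xs e') e'' pw

module _ {ℓ ℓ'} {A : Set ℓ} {_≤_ : A → A → Set ℓ'}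
         (po : IsPartialOrder _≡_ _≤_) (a : A) where

  open Lagging po a using (lagging-extension-absurd)
  open Lagging (Flip.isPartialOrder po) a using ()
    renaming (lagging-extension-absurd to leading-extension-absurd)

  extension-≤-antisym : ∀ {w u' u''} → All (_≢ a) w →
    u' IsExtOf w by a → u'' IsExtOf w by a → Pointwise _≤_ u' u'' → u' ≡ u''
  extension-≤-antisym fresh ext-[] ext-[] [] = refl
  extension-≤-antisym fresh (ext-ins e') (ext-ins e'') (_ ∷ pw) =
    cong (a ∷_) (extension-≤-antisym fresh e' e'' pw)
  extension-≤-antisym (y≢a ∷ fresh) (ext-ins e') (ext-keep e'') (a≤y ∷ pw) =
    ⊥-elim (lagging-extension-absurd ((a≤y , ≢-sym y≢a) ∷ []) fresh e' e'' pw)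
  extension-≤-antisym (x≢a ∷ fresh) (ext-keep e') (ext-ins e'') (x≤a ∷ pw) =
    ⊥-elim (leading-extension-absurd ((x≤a , ≢-sym x≢a) ∷ []) fresh e'' e'
      (Pointwise.symmetric (λ p → p) pw))
  extension-≤-antisym (_ ∷ fresh) (ext-keep e') (ext-keep e'') (_ ∷ pw) =
    cong (_ ∷_) (extension-≤-antisym fresh e' e'' pw)

-- The length hypothesis is redundant: Pointwise already forces equal lengths.
lemma2p3 : ∀ {ℓ ℓ'} {A : Set ℓ} (_≤_ : A → A → Set ℓ') → IsPartialOrder _≡_ _≤_ →
    (a : A) (w w' w'' : List A) → All (λ x → x ≢ a) w →
    w' IsExtOf w by a → w'' IsExtOf w by a → length w' ≡ length w'' →
    Pointwise _≤_ w' w'' → w' ≡ w''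
lemma2p3 _≤_ po a w w' w'' fresh e' e'' _ pw = extension-≤-antisym po a fresh e' e'' pw
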